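{- Let $x$ be a $\lambda$-Martin-L\"of random real in $[0,1]$, let $b \geq 2$ be an integer, and let $p_0, \dotsc, p_{b-1}$ be positive rational numbers summing to $1$, with $p_i = a_i/b_i$ in lowest terms. Let $d = \mathrm{lcm}(b_0, \dotsc, b_{b-1})$, let $g$ be the base-$b$ block of length $d$ consisting of $p_0 d$ copies of $0$, then $p_1 d$ copies of $1$, \dots, then $p_{b-1}d$ copies of $b-1$, and define $\beta \in b^{\omega}$ by $\beta[k] = g[(x)_d[k]]$ for all $k$, where $(x)_d$ is the base-$d$ digit sequence of $x$. Then $\beta$ is Bernoulli random with respect to $p_0, \dotsc, p_{b-1}$, i.e. $\beta$ is $\mu_{\bar{p}}$-Martin-L\"of random.
   Context: For a real $x$ and base $B$, $(x)_B$ is the base-$B$ digit sequence of $x$ with infinitely many digits different from $B-1$, indexed from $0$. $\lambda$ is Lebesgue measure (on $[0,1]$, equivalently the uniform product measure on $B^{\omega}$ for any base $B$). The Bernoulli measure $\mu_{\bar{p}}$ on $b^{\omega}$ is the Borel probability measure with $\mu_{\bar{p}}(\{\text{sequences extending }\sigma\}) = \prod_{j=0}^{\mathrm{len}(\sigma)-1} p_{\sigma[j]}$ for each finite block $\sigma$. For a measure $\mu$, a $\mu$-Martin-L\"of test is a uniformly computably enumerable sequence $(\mathcal{U}_i)_{i\in\omega}$ of effectively open sets with $\mu(\mathcal{U}_i)\le 2^{ -i}$; a point is $\mu$-Martin-L\"of random if it lies outside $\bigcap_i \mathcal{U}_i$ for every such test. -}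

module Defs where

open import Data.Nat as ℕ using (ℕ; zero; suc; _%_; _≤_)
open import Data.Nat.LCM using (lcm)
open import Data.Nat.DivMod using (m%n<n)
open import Data.Fin as Fin using (Fin; toℕ; fromℕ<)
open import Data.Vec as Vec using (Vec; []; _∷_)
open import Data.List as List using (List; []; _∷_; _++_; replicate; concatMap; map; allFin; foldr)
open import Data.Bool using (Bool; true; false; _∧_; _∨_)
open import Data.Integer as ℤ using (+_)
open import Data.Rational as ℚ using (ℚ; 0ℚ; 1ℚ; ↥_; ↧ₙ_)
open import Data.Product using (Σ; ∃; _×_; _,_)
open import Data.Unit using (⊤)
open import Relation.Nullary using (¬_; does)
open import Relation.Binary.PropositionalEquality using (_≡_)

Seq : ℕ → Set
Seq k = ℕ → Fin k

Str : ℕ → Set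
Str k = List (Fin k)

Extends : ∀ {k} → Seq k → Str k → Set
Extends α []      = ⊤
Extends α (c ∷ σ) = (α 0 ≡ c) × Extends (λ n → α (suc n)) σ

isPrefix : ∀ {k} → Str k → Str k → Bool
isPrefix []      _       = true
isPrefix (_ ∷ _) []      = false
isPrefix (c ∷ σ) (d ∷ τ) = does (c Fin.≟ d) ∧ isPrefix σ τ

strs : ∀ k → ℕ → List (Str k)
strs k zero    = [] ∷ []
strs k (suc n) = concatMap (λ c → map (c ∷_) (strs k n)) (allFin k)

sumℚ : List ℚ → ℚ
sumℚ = foldr ℚ._+_ 0ℚ

weight : ∀ {k} → (Fin k → ℚ) → Str k → ℚ
weight p []      = 1ℚ
weight p (c ∷ σ) = p c ℚ.* weight p σ

maxLen : ∀ {k} → List (Str k) → ℕ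
maxLen []      = 0
maxLen (σ ∷ L) = List.length σ ℕ.⊔ maxLen L

anyPrefix : ∀ {k} → List (Str k) → Str k → Bool
anyPrefix []      τ = false
anyPrefix (σ ∷ L) τ = isPrefix σ τ ∨ anyPrefix L τ

-- μ_p ( ⋃_{σ ∈ L} [σ] ), computed by refining to a common length
measU : ∀ {k} → (Fin k → ℚ) → List (Str k) → ℚ
measU {k} p L =
  sumℚ (map (weight p) (List.filterᵇ (anyPrefix L) (strs k (maxLen L))))

data PR : ℕ → Set where
  pzero : ∀ {n} → PR n
  psucc : PR 1
  proj  : ∀ {n} → Fin n → PR n
  comp  : ∀ {m n} → PR m → Vec (PR n) m → PR n
  prec  : ∀ {n} → PR n → PR (suc (suc n)) → PR (suc n)

mutual
  eval : ∀ {n} → PR n → Vec ℕ n → ℕ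
  eval pzero      xs            = 0
  eval psucc      (x ∷ [])      = suc x
  eval (proj i)   xs            = Vec.lookup xs i
  eval (comp f gs) xs           = eval f (evalV gs xs)
  eval (prec f g) (zero ∷ xs)   = eval f xs
  eval (prec f g) (suc y ∷ xs)  = eval g (y ∷ eval (prec f g) (y ∷ xs) ∷ xs)

  evalV : ∀ {m n} → Vec (PR n) m → Vec ℕ n → Vec ℕ m
  evalV []       xs = []
  evalV (g ∷ gs) xs = eval g xs ∷ evalV gs xs

-- Coding natural numbers as strings (bijective base-k numeration):
-- 0 ↦ [],  suc n ↦ (n mod k) ∷ decode (n div k).   Surjective onto Str k.

decodeF : ∀ k → ℕ → ℕ → Str k
decodeF zero    _        _       = []
decodeF (suc k) zero     _       = []
decodeF (suc k) (suc f)  zero    = []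
decodeF (suc k) (suc f)  (suc n) =
  fromℕ< (m%n<n n (suc k)) ∷ decodeF (suc k) f (n ℕ./ suc k)

decode : ∀ k → ℕ → Str k
decode k n = decodeF k n n

-- Uniformly c.e. sequences of sets of strings: a primitive recursive
-- f : ℕ² → ℕ enumerates U_i = { decode k | ∃ s. f(i,s) = suc k }
-- (output 0 = "nothing enumerated at this stage").

enumUpTo : ∀ k → PR 2 → ℕ → ℕ → List (Str k)
enumUpTo k f i zero = []
enumUpTo k f i (suc s) with eval f (i ∷ s ∷ [])
... | zero  = enumUpTo k f i s
... | suc c = decode k c ∷ enumUpTo k f i s

-- μ_p-Martin-Löf test: μ_p(U_i) ≤ 2^{-i}, i.e. every finite stage of the
-- enumeration of U_i has measure ≤ 2^{-i}.
record MLTest (k : ℕ) (p : Fin k → ℚ) : Set where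
  field
    code  : PR 2
    bound : ∀ i s → measU p (enumUpTo k code i s) ℚ.* ((+ (2 ℕ.^ i)) ℚ./ 1) ℚ.≤ 1ℚ

open MLTest public

Covers : ∀ {k p} → MLTest k p → Seq k → Set
Covers {k} T α = ∀ (i : ℕ) → Σ ℕ λ s → Σ ℕ λ c →
  (eval (code T) (i ∷ s ∷ []) ≡ suc c) × Extends α (decode k c)

MLRandom : ∀ k → (Fin k → ℚ) → Seq k → Set
MLRandom k p α = ∀ (T : MLTest k p) → ¬ Covers T α

-- Lebesgue (uniform) measure on Fin d ^ ω

uniformP : ∀ d → Fin d → ℚ
uniformP zero    ()
uniformP (suc d) _ = (+ 1) ℚ./ suc d

lcmDen : ∀ {b} → (Fin b → ℚ) → ℕ
lcmDen {b} p = foldr (λ i acc → lcm (↧ₙ (p i)) acc) 1 (allFin b)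

-- p_i · d  (as a natural number; p_i > 0)
copies : ∀ {b} → (Fin b → ℚ) → Fin b → ℕ
copies p i = ℤ.∣ ↥ (p i) ∣ ℕ.* (lcmDen p ℕ./ ↧ₙ (p i))

gBlock : ∀ {b} → (Fin b → ℚ) → List (Fin b)
gBlock {b} p = concatMap (λ i → replicate (copies p i) i) (allFin b)

nthOr : ∀ {A : Set} → A → List A → ℕ → A
nthOr a []       _       = a
nthOr a (x ∷ xs) zero    = x
nthOr a (x ∷ xs) (suc n) = nthOr a xs n

-- g[j]  (the default is never used when |g| = d and j < d)
gAt : ∀ {n} → (Fin (suc (suc n)) → ℚ) → ℕ → Fin (suc (suc n))
gAt p j = nthOr Fin.zero (gBlock p) j

beta : ∀ {n} (p : Fin (suc (suc n)) → ℚ) → Seq (lcmDen p) → Seq (suc (suc n))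
beta p x k = gAt p (toℕ (x k))

-- The letter map a ↦ g[a] sends the uniform distribution on d letters to p, since letter i fills p_i·d of
-- the d places of g; letter by letter it therefore sends λ to μ_p on cylinders. So a μ_p-Martin-Löf test
-- pulls back to a λ-Martin-Löf test with the same bounds: its i-th level enumerates, at stage s, the string
-- coded by s as soon as the image of that string extends a string enumerated so far into the i-th level of
-- the given test. If β = g ∘ x lay in every level of the given test, x would lie in every level of the pulled-back
-- test, contradicting λ-randomness of x. The pulled-back test is given by an explicit primitive recursive code.

module Submission where

open import Defs
open import Data.Bool using (Bool; true; false; _∧_; _∨_; if_then_else_)
open import Data.Bool.Properties using (∨-zeroʳ)
open import Data.Empty using (⊥-elim)
open import Data.Fin as Fin using (Fin; toℕ; fromℕ<)
open import Data.Fin.Properties using (¬Fin0; toℕ<n; toℕ-fromℕ<; toℕ-injective)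
open import Data.Integer as ℤ using (+_; -[1+_])
import Data.Integer.Properties as ℤP
open import Data.List as List using (List; []; _∷_; _++_; map; length; allFin; replicate; concatMap; filterᵇ; tabulate; take)
import Data.List.Properties as Listₚ
open import Data.List.Membership.Propositional using (_∈_)
open import Data.List.Membership.Propositional.Properties using (∈-allFin)
open import Data.List.Relation.Unary.All as All using (All; []; _∷_)
open import Data.List.Relation.Unary.Any using (here; there)
open import Data.Nat
open import Data.Nat.Coprimality using (1-coprimeTo)
import Data.Nat.Coprimality as Coprime
open import Data.Nat.DivMod
open import Data.Nat.Divisibility using (_∣_; ∣-trans; n∣m*n)
open import Data.Nat.GeneralisedArithmetic using (fold; iterate; iterate-is-fold)
open import Data.Nat.LCM using (lcm; m∣lcm[m,n]; n∣lcm[m,n])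
open import Data.Nat.Properties
open import Data.Nat.Tactic.RingSolver using (solve-∀)
open import Data.Product using (Σ; _×_; _,_)
open import Data.Rational as ℚ using (ℚ; mkℚ; 0ℚ; 1ℚ; ↥_; ↧ₙ_; toℚᵘ)
import Data.Rational.Properties as ℚP
open import Data.Rational.Unnormalised as ℚᵘ using (mkℚᵘ; *≡*)
import Data.Rational.Unnormalised.Properties as ℚᵘP
open import Data.Vec as Vec using (Vec; []; _∷_)
open import Data.Vec.Properties using (tabulate∘lookup)
open import Relation.Binary.PropositionalEquality
open import Relation.Nullary using (yes; no; does)
open import Relation.Nullary.Decidable using (dec-true)

-- Primitive recursive arithmetic

comp₁ : ∀ {n} → PR 1 → PR n → PR n
comp₁ f a = comp f (a ∷ [])

comp₂ : ∀ {n} → PR 2 → PR n → PR n → PR n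
comp₂ f a b = comp f (a ∷ b ∷ [])

var₀ : ∀ {n} → PR (suc n)
var₀ = proj Fin.zero

var₁ : ∀ {n} → PR (suc (suc n))
var₁ = proj (Fin.suc Fin.zero)

var₂ : ∀ {n} → PR (suc (suc (suc n)))
var₂ = proj (Fin.suc (Fin.suc Fin.zero))

constPR : ∀ {n} → ℕ → PR n
constPR zero    = pzero
constPR (suc c) = comp₁ psucc (constPR c)

eval-constPR : ∀ {n} c (xs : Vec ℕ n) → eval (constPR c) xs ≡ c
eval-constPR zero    xs = refl
eval-constPR (suc c) xs = cong suc (eval-constPR c xs)

addPR : PR 2
addPR = prec var₀ (comp₁ psucc var₁)

eval-addPR : ∀ y x → eval addPR (y ∷ x ∷ []) ≡ y + x
eval-addPR zero    x = refl
eval-addPR (suc y) x = cong suc (eval-addPR y x)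

predPR : PR 1
predPR = prec pzero var₀

eval-predPR : ∀ y → eval predPR (y ∷ []) ≡ pred y
eval-predPR zero    = refl
eval-predPR (suc y) = refl

-- truncated subtraction with the arguments swapped: (y , x) ↦ x ∸ y
monusPR : PR 2
monusPR = prec var₀ (comp₁ predPR var₁)

eval-monusPR : ∀ y x → eval monusPR (y ∷ x ∷ []) ≡ x ∸ y
eval-monusPR zero    x = refl
eval-monusPR (suc y) x = begin
  eval predPR (eval monusPR (y ∷ x ∷ []) ∷ []) ≡⟨ eval-predPR (eval monusPR (y ∷ x ∷ [])) ⟩
  pred (eval monusPR (y ∷ x ∷ []))             ≡⟨ cong pred (eval-monusPR y x) ⟩
  pred (x ∸ y)                                 ≡⟨ pred[m∸n]≡m∸[1+n] x y ⟩
  x ∸ suc y                                    ∎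
  where open ≡-Reasoning

mulPR : PR 2
mulPR = prec pzero (comp₂ addPR var₁ var₂)

eval-mulPR : ∀ y x → eval mulPR (y ∷ x ∷ []) ≡ y * x
eval-mulPR zero    x = refl
eval-mulPR (suc y) x = begin
  eval addPR (eval mulPR (y ∷ x ∷ []) ∷ x ∷ []) ≡⟨ eval-addPR _ x ⟩
  eval mulPR (y ∷ x ∷ []) + x                   ≡⟨ cong (_+ x) (eval-mulPR y x) ⟩
  y * x + x                                     ≡⟨ +-comm (y * x) x ⟩
  x + y * x                                     ∎
  where open ≡-Reasoning

isZero : ℕ → ℕ
isZero zero    = 1
isZero (suc _) = 0

signum : ℕ → ℕ
signum zero    = 0
signum (suc _) = 1

isZero-+ : ∀ a b → isZero (a + b) ≡ isZero a * isZero b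
isZero-+ zero    b = sym (+-identityʳ (isZero b))
isZero-+ (suc a) b = refl

isZeroPR : PR 1
isZeroPR = prec (constPR 1) pzero

eval-isZeroPR : ∀ y → eval isZeroPR (y ∷ []) ≡ isZero y
eval-isZeroPR zero    = refl
eval-isZeroPR (suc y) = refl

signumPR : PR 1
signumPR = prec pzero (constPR 1)

eval-signumPR : ∀ y → eval signumPR (y ∷ []) ≡ signum y
eval-signumPR zero    = refl
eval-signumPR (suc y) = refl

distPR : PR 2
distPR = comp₂ addPR (comp₂ monusPR var₁ var₀) (comp₂ monusPR var₀ var₁)

∣m-n∣≡m∸n+n∸m : ∀ m n → ∣ m - n ∣ ≡ m ∸ n + (n ∸ m)
∣m-n∣≡m∸n+n∸m zero    zero    = refl
∣m-n∣≡m∸n+n∸m zero    (suc n) = refl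
∣m-n∣≡m∸n+n∸m (suc m) zero    = cong suc (sym (+-identityʳ m))
∣m-n∣≡m∸n+n∸m (suc m) (suc n) = ∣m-n∣≡m∸n+n∸m m n

eval-distPR : ∀ x y → eval distPR (x ∷ y ∷ []) ≡ ∣ x - y ∣
eval-distPR x y rewrite eval-monusPR y x | eval-monusPR x y = trans (eval-addPR (x ∸ y) (y ∸ x)) (sym (∣m-n∣≡m∸n+n∸m x y))

sum< : ℕ → (ℕ → ℕ) → ℕ
sum< zero    h = 0
sum< (suc y) h = sum< y h + h y

sum<-cong : ∀ y {h h′ : ℕ → ℕ} → (∀ t → h t ≡ h′ t) → sum< y h ≡ sum< y h′
sum<-cong zero    eq = refl
sum<-cong (suc y) eq = cong₂ _+_ (sum<-cong y eq) (eq y)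

sum<-suc : ∀ K h → sum< (suc K) h ≡ h 0 + sum< K (λ j → h (suc j))
sum<-suc zero    h = +-comm 0 (h 0)
sum<-suc (suc K) h rewrite sum<-suc K h = +-assoc (h 0) _ _

sum<-zero : ∀ K → sum< K (λ _ → 0) ≡ 0
sum<-zero zero    = refl
sum<-zero (suc K) rewrite sum<-zero K = refl

evalV-tabulate : ∀ {m n} (g : Fin m → PR n) xs → evalV (Vec.tabulate g) xs ≡ Vec.tabulate (λ k → eval (g k) xs)
evalV-tabulate {zero}  g xs = refl
evalV-tabulate {suc m} g xs = cong (eval (g Fin.zero) xs ∷_) (evalV-tabulate (λ k → g (Fin.suc k)) xs)

dropVars₂ : ∀ {n} → Vec (PR (suc (suc n))) n
dropVars₂ = Vec.tabulate (λ k → proj (Fin.suc (Fin.suc k)))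

evalV-dropVars₂ : ∀ {n} a b (xs : Vec ℕ n) → evalV dropVars₂ (a ∷ b ∷ xs) ≡ xs
evalV-dropVars₂ a b xs = trans (evalV-tabulate _ _) (tabulate∘lookup xs)

sumPR : ∀ {n} → PR (suc n) → PR (suc n)
sumPR h = prec pzero (comp₂ addPR var₁ (comp h (var₀ ∷ dropVars₂)))

eval-sumPR : ∀ {n} (h : PR (suc n)) y xs → eval (sumPR h) (y ∷ xs) ≡ sum< y (λ t → eval h (t ∷ xs))
eval-sumPR h zero    xs = refl
eval-sumPR h (suc y) xs = begin
  eval addPR (eval (sumPR h) (y ∷ xs) ∷ eval h (y ∷ evalV dropVars₂ (y ∷ eval (sumPR h) (y ∷ xs) ∷ xs)) ∷ [])
    ≡⟨ eval-addPR (eval (sumPR h) (y ∷ xs)) _ ⟩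
  eval (sumPR h) (y ∷ xs) + eval h (y ∷ evalV dropVars₂ (y ∷ eval (sumPR h) (y ∷ xs) ∷ xs))
    ≡⟨ cong₂ _+_ (eval-sumPR h y xs) (cong (λ v → eval h (y ∷ v)) (evalV-dropVars₂ y _ xs)) ⟩
  sum< y (λ t → eval h (t ∷ xs)) + eval h (y ∷ xs)
    ∎
  where open ≡-Reasoning

isZero-∸-≤ : ∀ {a b} → a ≤ b → isZero (a ∸ b) ≡ 1
isZero-∸-≤ a≤b rewrite m≤n⇒m∸n≡0 a≤b = refl

isZero-∸-> : ∀ {a b} → b < a → isZero (a ∸ b) ≡ 0
isZero-∸-> {suc a} {zero}  b<a       = refl
isZero-∸-> {suc a} {suc b} (s≤s b<a) = isZero-∸-> b<a

sum<-isZero-∸ : ∀ y m → sum< y (λ t → isZero (suc t ∸ m)) ≡ y ⊓ m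
sum<-isZero-∸ zero    m = refl
sum<-isZero-∸ (suc y) m with y <? m
... | yes y<m rewrite sum<-isZero-∸ y m | m≤n⇒m⊓n≡m (<⇒≤ y<m) | isZero-∸-≤ y<m | m≤n⇒m⊓n≡m y<m = +-comm y 1
... | no y≮m  rewrite sum<-isZero-∸ y m | m≥n⇒m⊓n≡n (≮⇒≥ y≮m) | isZero-∸-> (s≤s (≮⇒≥ y≮m))
                    | m≥n⇒m⊓n≡n (m≤n⇒m≤1+n (≮⇒≥ y≮m)) = +-identityʳ m

iterate-fixed : ∀ {A : Set} (f : A → A) {x} → f x ≡ x → ∀ j → iterate f x j ≡ x
iterate-fixed f fx≡x zero    = refl
iterate-fixed f fx≡x (suc j) rewrite fx≡x = iterate-fixed f fx≡x j

module DivisionPR (q : ℕ) .{{_ : NonZero q}} where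

  -- x / q = #{ t < x ∣ (t + 1) * q ≤ x }
  divTermPR : PR 2
  divTermPR = comp₁ isZeroPR (comp₂ monusPR var₁ (comp₂ mulPR (comp₁ psucc var₀) (constPR q)))

  divPR : PR 1
  divPR = comp (sumPR divTermPR) (var₀ ∷ var₀ ∷ [])

  isZero-∸-/ : ∀ x t → isZero (suc t * q ∸ x) ≡ isZero (suc t ∸ x / q)
  isZero-∸-/ x t with suc t ≤? x / q
  ... | yes t<x/q = trans (isZero-∸-≤ (≤-trans (*-monoˡ-≤ q t<x/q) (m/n*n≤m x q))) (sym (isZero-∸-≤ t<x/q))
  ... | no t≮x/q  = trans (isZero-∸-> (≰⇒> (λ le → t≮x/q (subst (_≤ x / q) (m*n/n≡m (suc t) q) (/-monoˡ-≤ q le)))))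
                          (sym (isZero-∸-> (≰⇒> t≮x/q)))

  eval-divPR : ∀ x → eval divPR (x ∷ []) ≡ x / q
  eval-divPR x = begin
    eval (sumPR divTermPR) (x ∷ x ∷ [])        ≡⟨ eval-sumPR divTermPR x (x ∷ []) ⟩
    sum< x (λ t → eval divTermPR (t ∷ x ∷ [])) ≡⟨ sum<-cong x term ⟩
    sum< x (λ t → isZero (suc t * q ∸ x))      ≡⟨ sum<-cong x (isZero-∸-/ x) ⟩
    sum< x (λ t → isZero (suc t ∸ x / q))      ≡⟨ sum<-isZero-∸ x (x / q) ⟩
    x ⊓ (x / q)                                ≡⟨ m≥n⇒m⊓n≡n (m/n≤m x q) ⟩
    x / q                                      ∎
    where
    open ≡-Reasoning
    term : ∀ t → eval divTermPR (t ∷ x ∷ []) ≡ isZero (suc t * q ∸ x)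
    term t rewrite eval-mulPR (suc t) (eval (constPR q) (t ∷ x ∷ [])) | eval-constPR q (t ∷ x ∷ [])
                 | eval-monusPR x (suc t * q) = eval-isZeroPR _

  modPR : PR 1
  modPR = comp₂ monusPR (comp₂ mulPR (comp₁ divPR var₀) (constPR q)) var₀

  eval-modPR : ∀ x → eval modPR (x ∷ []) ≡ x % q
  eval-modPR x rewrite eval-mulPR (eval divPR (x ∷ [])) (eval (constPR q) (x ∷ [])) | eval-divPR x | eval-constPR q (x ∷ [])
    = trans (eval-monusPR (x / q * q) x) (sym (m%n≡m∸m/n*n x q))

  -- In bijective base q, decode (suc m) = (m % q) ∷ decode (m / q), so the tail has code pred c / q.
  tailCode : ℕ → ℕ
  tailCode c = pred c / q

  tailCodePR : PR 2
  tailCodePR = prec var₀ (comp₁ divPR (comp₁ predPR var₁))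

  eval-tailCodePR : ∀ j c → eval tailCodePR (j ∷ c ∷ []) ≡ iterate tailCode c j
  eval-tailCodePR j c = trans (go j) (iterate-is-fold c tailCode j)
    where
    go : ∀ j → eval tailCodePR (j ∷ c ∷ []) ≡ fold c tailCode j
    go zero    = refl
    go (suc j) rewrite eval-predPR (eval tailCodePR (j ∷ c ∷ [])) | go j = eval-divPR (pred (fold c tailCode j))

  iterate-tailCode-0 : ∀ j → iterate tailCode 0 j ≡ 0
  iterate-tailCode-0 = iterate-fixed tailCode (0/n≡0 q)

tablePR : List ℕ → PR 1
tablePR []      = pzero
tablePR (v ∷ L) = prec (constPR v) (comp₁ (tablePR L) var₀)

eval-tablePR : ∀ L j → eval (tablePR L) (j ∷ []) ≡ nthOr 0 L j
eval-tablePR []      j       = refl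
eval-tablePR (v ∷ L) zero    = eval-constPR v []
eval-tablePR (v ∷ L) (suc j) = eval-tablePR L j

nthOr-tabulate : ∀ {A : Set} {n} (a : A) (h : Fin n → A) i → nthOr a (tabulate h) (toℕ i) ≡ h i
nthOr-tabulate a h Fin.zero    = refl
nthOr-tabulate a h (Fin.suc i) = nthOr-tabulate a (λ j → h (Fin.suc j)) i

finitePR : ∀ {d b} → (Fin d → Fin b) → PR 1
finitePR G = tablePR (tabulate (λ a → toℕ (G a)))

eval-finitePR : ∀ {d b} (G : Fin d → Fin b) a → eval (finitePR G) (toℕ a ∷ []) ≡ toℕ (G a)
eval-finitePR G a = trans (eval-tablePR (tabulate (λ a → toℕ (G a))) (toℕ a)) (nthOr-tabulate 0 (λ a → toℕ (G a)) a)

isPrefix-trans : ∀ {k} (σ τ ρ : Str k) → isPrefix σ τ ≡ true → isPrefix τ ρ ≡ true → isPrefix σ ρ ≡ true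
isPrefix-trans []      τ       ρ       _  _  = refl
isPrefix-trans (c ∷ σ) (d ∷ τ) (e ∷ ρ) h₁ h₂ with c Fin.≟ d | d Fin.≟ e
... | yes refl | yes refl rewrite dec-true (c Fin.≟ c) refl = isPrefix-trans σ τ ρ h₁ h₂

isPrefix-map : ∀ {k k′} (G : Fin k → Fin k′) (τ ρ : Str k) → isPrefix τ ρ ≡ true → isPrefix (map G τ) (map G ρ) ≡ true
isPrefix-map G []      ρ       _ = refl
isPrefix-map G (c ∷ τ) (d ∷ ρ) h with c Fin.≟ d
... | yes refl rewrite dec-true (G c Fin.≟ G c) refl = isPrefix-map G τ ρ h

isPrefix-take : ∀ {k} (σ τ : Str k) M → length σ ≤ M → isPrefix σ τ ≡ isPrefix σ (take M τ)
isPrefix-take []      τ       M       _         = refl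
isPrefix-take (c ∷ σ) []      (suc M) _         = refl
isPrefix-take (c ∷ σ) (d ∷ τ) (suc M) (s≤s σ≤M) = cong (does (c Fin.≟ d) ∧_) (isPrefix-take σ τ M σ≤M)

anyPrefix-extend : ∀ {k} (L : List (Str k)) τ ρ → anyPrefix L τ ≡ true → isPrefix τ ρ ≡ true → anyPrefix L ρ ≡ true
anyPrefix-extend (σ ∷ L) τ ρ h₁ h₂ with isPrefix σ τ in σ≼τ
... | true  rewrite isPrefix-trans σ τ ρ σ≼τ h₂ = refl
... | false rewrite anyPrefix-extend L τ ρ h₁ h₂ = ∨-zeroʳ (isPrefix σ ρ)

anyPrefix-take : ∀ {k} (L : List (Str k)) τ M → maxLen L ≤ M → anyPrefix L τ ≡ anyPrefix L (take M τ)
anyPrefix-take []      τ M _ = refl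
anyPrefix-take (σ ∷ L) τ M L≤M =
  cong₂ _∨_ (isPrefix-take σ τ M (m⊔n≤o⇒m≤o (length σ) (maxLen L) L≤M))
            (anyPrefix-take L τ M (m⊔n≤o⇒n≤o (length σ) (maxLen L) L≤M))

anyPrefix-map-⊆ : ∀ {k k′} (G : Fin k → Fin k′) (L : List (Str k′)) (L′ : List (Str k)) →
  All (λ τ → anyPrefix L (map G τ) ≡ true) L′ → ∀ ρ → anyPrefix L′ ρ ≡ true → anyPrefix L (map G ρ) ≡ true
anyPrefix-map-⊆ G L (τ ∷ L′) (h ∷ hs) ρ h′ with isPrefix τ ρ in τ≼ρ
... | true  = anyPrefix-extend L (map G τ) (map G ρ) h (isPrefix-map G τ ρ τ≼ρ)
... | false = anyPrefix-map-⊆ G L L′ hs ρ h′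

prefixOf : ∀ {k} → Seq k → ℕ → Str k
prefixOf α zero    = []
prefixOf α (suc N) = α 0 ∷ prefixOf (λ n → α (suc n)) N

Extends-prefixOf : ∀ {k} (α : Seq k) N → Extends α (prefixOf α N)
Extends-prefixOf α zero    = _
Extends-prefixOf α (suc N) = refl , Extends-prefixOf (λ n → α (suc n)) N

length-prefixOf : ∀ {k} (α : Seq k) N → length (prefixOf α N) ≡ N
length-prefixOf α zero    = refl
length-prefixOf α (suc N) = cong suc (length-prefixOf (λ n → α (suc n)) N)

map-prefixOf : ∀ {k k′} (G : Fin k → Fin k′) (α : Seq k) N → map G (prefixOf α N) ≡ prefixOf (λ n → G (α n)) N
map-prefixOf G α zero    = refl
map-prefixOf G α (suc N) = cong (G (α 0) ∷_) (map-prefixOf G (λ n → α (suc n)) N)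

Extends⇒isPrefix-prefixOf : ∀ {k} (α : Seq k) σ N → Extends α σ → length σ ≤ N → isPrefix σ (prefixOf α N) ≡ true
Extends⇒isPrefix-prefixOf α []      N       _          _         = refl
Extends⇒isPrefix-prefixOf α (c ∷ σ) (suc N) (refl , e) (s≤s σ≤N) rewrite dec-true (α 0 Fin.≟ α 0) refl =
  Extends⇒isPrefix-prefixOf (λ n → α (suc n)) σ N e σ≤N

decodeF-fuel-irrelevant : ∀ k a a′ n → n ≤ a → n ≤ a′ → decodeF (suc k) a n ≡ decodeF (suc k) a′ n
decodeF-fuel-irrelevant k zero    zero     n       _       _        = refl
decodeF-fuel-irrelevant k zero    (suc a′) zero    _       _        = refl
decodeF-fuel-irrelevant k (suc a) zero     zero    _       _        = refl
decodeF-fuel-irrelevant k (suc a) (suc a′) zero    _       _        = refl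
decodeF-fuel-irrelevant k (suc a) (suc a′) (suc n) (s≤s n≤a) (s≤s n≤a′) =
  cong (_ ∷_) (decodeF-fuel-irrelevant k a a′ (n / suc k) (≤-trans (m/n≤m n (suc k)) n≤a) (≤-trans (m/n≤m n (suc k)) n≤a′))

decode-suc : ∀ k m → decode (suc k) (suc m) ≡ fromℕ< (m%n<n m (suc k)) ∷ decode (suc k) (m / suc k)
decode-suc k m = cong (fromℕ< (m%n<n m (suc k)) ∷_) (decodeF-fuel-irrelevant k m (m / suc k) (m / suc k) (m/n≤m m (suc k)) ≤-refl)

encode : ∀ {k} → Str (suc k) → ℕ
encode         []      = 0
encode {k = k} (a ∷ σ) = suc (toℕ a + encode σ * suc k)

length≤encode : ∀ {k} (σ : Str (suc k)) → length σ ≤ encode σ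
length≤encode         []      = z≤n
length≤encode {k = k} (a ∷ σ) =
  s≤s (≤-trans (length≤encode σ) (≤-trans (m≤m*n (encode σ) (suc k)) (m≤n+m _ (toℕ a))))

decode-encode : ∀ {k} (σ : Str (suc k)) → decode (suc k) (encode σ) ≡ σ
decode-encode         []      = refl
decode-encode {k = k} (a ∷ σ) = trans (decode-suc k m) (cong₂ _∷_ head-digit (trans (cong (decode (suc k)) m/q≡) (decode-encode σ)))
  where
  m = toℕ a + encode σ * suc k
  head-digit : fromℕ< (m%n<n m (suc k)) ≡ a
  head-digit = toℕ-injective (trans (toℕ-fromℕ< _) (trans ([m+kn]%n≡m%n (toℕ a) (encode σ) (suc k)) (m<n⇒m%n≡m (toℕ<n a))))
  m/q≡ : m / suc k ≡ encode σ
  m/q≡ = trans (+-distrib-/-∣ʳ (toℕ a) (n∣m*n (encode σ))) (cong₂ _+_ (m<n⇒m/n≡0 (toℕ<n a)) (m*n/n≡m (encode σ) (suc k)))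

anyPrefix-enumUpTo-suc : ∀ k f i s ρ → anyPrefix (enumUpTo k f i s) ρ ≡ true → anyPrefix (enumUpTo k f i (suc s)) ρ ≡ true
anyPrefix-enumUpTo-suc k f i s ρ h with eval f (i ∷ s ∷ [])
... | zero  = h
... | suc c rewrite h = ∨-zeroʳ (isPrefix (decode k c) ρ)

anyPrefix-enumUpTo-mono : ∀ k f i {s s′} ρ → s ≤ s′ →
  anyPrefix (enumUpTo k f i s) ρ ≡ true → anyPrefix (enumUpTo k f i s′) ρ ≡ true
anyPrefix-enumUpTo-mono k f i ρ s≤s′ = go (≤⇒≤′ s≤s′)
  where
  go : ∀ {s s′} → s ≤′ s′ → anyPrefix (enumUpTo k f i s) ρ ≡ true → anyPrefix (enumUpTo k f i s′) ρ ≡ true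
  go ≤′-refl        h = h
  go (≤′-step s≤′s′) h = anyPrefix-enumUpTo-suc k f i _ ρ (go s≤′s′ h)

anyPrefix-enumUpTo-hit : ∀ k f i s c ρ → eval f (i ∷ s ∷ []) ≡ suc c → isPrefix (decode k c) ρ ≡ true →
  anyPrefix (enumUpTo k f i (suc s)) ρ ≡ true
anyPrefix-enumUpTo-hit k f i s c ρ eq h with eval f (i ∷ s ∷ [])
anyPrefix-enumUpTo-hit k f i s c ρ refl h | .(suc c) rewrite h = refl

-- Deciding prefixes of codes primitive recursively

fromBool : Bool → ℕ
fromBool true  = 1
fromBool false = 0

fromBool-∧ : ∀ a b → fromBool (a ∧ b) ≡ fromBool a * fromBool b
fromBool-∧ true  b = sym (+-identityʳ (fromBool b))
fromBool-∧ false b = refl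

isZero-signum-∣-∣ : ∀ {n} (u v : Fin n) → isZero (signum ∣ toℕ u - toℕ v ∣) ≡ fromBool (does (u Fin.≟ v))
isZero-signum-∣-∣ u v with u Fin.≟ v
... | yes refl rewrite ∣n-n∣≡0 (toℕ u) = refl
... | no u≢v with ∣ toℕ u - toℕ v ∣ in eq
...   | zero  = ⊥-elim (u≢v (toℕ-injective (∣m-n∣≡0⇒m≡n eq)))
...   | suc _ = refl

module PrefixTestPR {kb kd} (G : Fin (suc kd) → Fin (suc kb)) where

  module B = DivisionPR (suc kb)
  module D = DivisionPR (suc kd)

  Gℕ : ℕ → ℕ
  Gℕ v = eval (finitePR G) (v ∷ [])

  -- 1 iff the string coded by c is nonempty and the G-image of the string coded by e does not start with its
  -- first letter; the first letters of the strings coded by c and e are pred c % suc kb and pred e % suc kd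
  headMismatch : ℕ → ℕ → ℕ
  headMismatch c e = signum c * (isZero e + signum ∣ pred c % suc kb - Gℕ (pred e % suc kd) ∣)

  headMismatchPR : PR 2
  headMismatchPR = comp₂ mulPR (comp₁ signumPR var₀) (comp₂ addPR (comp₁ isZeroPR var₁)
    (comp₁ signumPR (comp₂ distPR (comp₁ B.modPR (comp₁ predPR var₀)) (comp₁ (finitePR G) (comp₁ D.modPR (comp₁ predPR var₁))))))

  eval-headMismatchPR : ∀ c e → eval headMismatchPR (c ∷ e ∷ []) ≡ headMismatch c e
  eval-headMismatchPR c e
    rewrite eval-predPR c | eval-predPR e | B.eval-modPR (pred c) | D.eval-modPR (pred e)
          | eval-distPR (pred c % suc kb) (Gℕ (pred e % suc kd))
          | eval-signumPR ∣ pred c % suc kb - Gℕ (pred e % suc kd) ∣ | eval-isZeroPR e | eval-signumPR c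
          | eval-addPR (isZero e) (signum ∣ pred c % suc kb - Gℕ (pred e % suc kd) ∣)
          = eval-mulPR (signum c) _

  mismatch : ℕ → ℕ → ℕ → ℕ
  mismatch j c e = headMismatch (iterate B.tailCode c j) (iterate D.tailCode e j)

  mismatchPR : PR 3
  mismatchPR = comp₂ headMismatchPR (comp₂ B.tailCodePR var₀ var₁) (comp₂ D.tailCodePR var₀ var₂)

  eval-mismatchPR : ∀ j c e → eval mismatchPR (j ∷ c ∷ e ∷ []) ≡ mismatch j c e
  eval-mismatchPR j c e rewrite B.eval-tailCodePR j c | D.eval-tailCodePR j e =
    eval-headMismatchPR (iterate B.tailCode c j) (iterate D.tailCode e j)

  isZero-mismatch-head : ∀ m m′ → isZero (mismatch 0 (suc m) (suc m′))
                                ≡ fromBool (does (fromℕ< (m%n<n m (suc kb)) Fin.≟ G (fromℕ< (m%n<n m′ (suc kd)))))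
  isZero-mismatch-head m m′ = begin
    isZero (1 * (0 + signum ∣ m % suc kb - Gℕ (m′ % suc kd) ∣))
      ≡⟨ cong isZero (*-identityˡ _) ⟩
    isZero (signum ∣ m % suc kb - Gℕ (m′ % suc kd) ∣)
      ≡⟨ cong₂ (λ u v → isZero (signum ∣ u - Gℕ v ∣)) (sym (toℕ-fromℕ< (m%n<n m (suc kb)))) (sym (toℕ-fromℕ< (m%n<n m′ (suc kd)))) ⟩
    isZero (signum ∣ toℕ a - Gℕ (toℕ a′) ∣)
      ≡⟨ cong (λ v → isZero (signum ∣ toℕ a - v ∣)) (eval-finitePR G a′) ⟩
    isZero (signum ∣ toℕ a - toℕ (G a′) ∣)
      ≡⟨ isZero-signum-∣-∣ a (G a′) ⟩
    fromBool (does (a Fin.≟ G a′))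
      ∎
    where
    open ≡-Reasoning
    a  = fromℕ< (m%n<n m (suc kb))
    a′ = fromℕ< (m%n<n m′ (suc kd))

  noMismatch : ℕ → ℕ → ℕ → ℕ
  noMismatch K c e = isZero (sum< K (λ j → mismatch j c e))

  noMismatch-suc : ∀ K c e → noMismatch (suc K) c e ≡ isZero (mismatch 0 c e) * noMismatch K (B.tailCode c) (D.tailCode e)
  noMismatch-suc K c e = trans (cong isZero (sum<-suc K (λ j → mismatch j c e))) (isZero-+ (mismatch 0 c e) _)

  noMismatch-0 : ∀ K e → noMismatch K 0 e ≡ 1
  noMismatch-0 K e = cong isZero (trans (sum<-cong K no-letter) (sum<-zero K))
    where
    no-letter : ∀ j → mismatch j 0 e ≡ 0
    no-letter j = cong (λ u → headMismatch u (iterate D.tailCode e j)) (B.iterate-tailCode-0 j)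

  -- decode c has at most c letters, so K > c steps compare all of them
  noMismatch≡isPrefix : ∀ K c e → c < K → noMismatch K c e ≡ fromBool (isPrefix (decode (suc kb) c) (map G (decode (suc kd) e)))
  noMismatch≡isPrefix K       zero    e        _         = noMismatch-0 K e
  noMismatch≡isPrefix (suc K) (suc m) zero     _         rewrite noMismatch-suc K (suc m) zero = refl
  noMismatch≡isPrefix (suc K) (suc m) (suc m′) (s≤s m<K) = begin
    noMismatch (suc K) (suc m) (suc m′)
      ≡⟨ noMismatch-suc K (suc m) (suc m′) ⟩
    isZero (mismatch 0 (suc m) (suc m′)) * noMismatch K (m / suc kb) (m′ / suc kd)
      ≡⟨ cong₂ _*_ (isZero-mismatch-head m m′) (noMismatch≡isPrefix K (m / suc kb) (m′ / suc kd) m/q<K) ⟩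
    fromBool (does (a Fin.≟ G a′)) * fromBool (isPrefix (decode (suc kb) (m / suc kb)) (map G (decode (suc kd) (m′ / suc kd))))
      ≡⟨ sym (fromBool-∧ (does (a Fin.≟ G a′)) _) ⟩
    fromBool (isPrefix (a ∷ decode (suc kb) (m / suc kb)) (map G (a′ ∷ decode (suc kd) (m′ / suc kd))))
      ≡⟨ sym (cong₂ (λ u v → fromBool (isPrefix u (map G v))) (decode-suc kb m) (decode-suc kd m′)) ⟩
    fromBool (isPrefix (decode (suc kb) (suc m)) (map G (decode (suc kd) (suc m′))))
      ∎
    where
    open ≡-Reasoning
    a  = fromℕ< (m%n<n m (suc kb))
    a′ = fromℕ< (m%n<n m′ (suc kd))
    m/q<K = ≤-<-trans (m/n≤m m (suc kb)) m<K

  prefixTestPR : PR 2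
  prefixTestPR = comp₁ isZeroPR (comp (sumPR mismatchPR) (comp₁ psucc var₀ ∷ var₀ ∷ var₁ ∷ []))

  eval-prefixTestPR : ∀ c e → eval prefixTestPR (c ∷ e ∷ []) ≡ fromBool (isPrefix (decode (suc kb) c) (map G (decode (suc kd) e)))
  eval-prefixTestPR c e rewrite eval-sumPR mismatchPR (suc c) (c ∷ e ∷ []) | sum<-cong (suc c) (λ j → eval-mismatchPR j c e) =
    trans (eval-isZeroPR _) (noMismatch≡isPrefix (suc c) c e ≤-refl)

sumℚ-++ : ∀ xs ys → sumℚ (xs ++ ys) ≡ sumℚ xs ℚ.+ sumℚ ys
sumℚ-++ []       ys = sym (ℚP.+-identityˡ _)
sumℚ-++ (x ∷ xs) ys rewrite sumℚ-++ xs ys = sym (ℚP.+-assoc x _ _)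

sumℚ-concatMap : ∀ {A B : Set} (h : B → ℚ) (F : A → List B) xs →
  sumℚ (map h (concatMap F xs)) ≡ sumℚ (map (λ x → sumℚ (map h (F x))) xs)
sumℚ-concatMap h F []       = refl
sumℚ-concatMap h F (x ∷ xs) = begin
  sumℚ (map h (F x ++ concatMap F xs))                     ≡⟨ cong sumℚ (Listₚ.map-++ h (F x) (concatMap F xs)) ⟩
  sumℚ (map h (F x) ++ map h (concatMap F xs))             ≡⟨ sumℚ-++ (map h (F x)) _ ⟩
  sumℚ (map h (F x)) ℚ.+ sumℚ (map h (concatMap F xs))     ≡⟨ cong (sumℚ (map h (F x)) ℚ.+_) (sumℚ-concatMap h F xs) ⟩
  sumℚ (map h (F x)) ℚ.+ sumℚ (map (λ y → sumℚ (map h (F y))) xs)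
                                                           ∎
  where open ≡-Reasoning

sumℚ-cong : ∀ {A : Set} {h h′ : A → ℚ} → (∀ x → h x ≡ h′ x) → ∀ xs → sumℚ (map h xs) ≡ sumℚ (map h′ xs)
sumℚ-cong eq xs = cong sumℚ (Listₚ.map-cong eq xs)

sumℚ-mono : ∀ {A : Set} {h h′ : A → ℚ} → (∀ x → h x ℚ.≤ h′ x) → ∀ xs → sumℚ (map h xs) ℚ.≤ sumℚ (map h′ xs)
sumℚ-mono le []       = ℚP.≤-refl
sumℚ-mono le (x ∷ xs) = ℚP.+-mono-≤ (le x) (sumℚ-mono le xs)

sumℚ-*ˡ : ∀ {A : Set} a (h : A → ℚ) xs → sumℚ (map (λ x → a ℚ.* h x) xs) ≡ a ℚ.* sumℚ (map h xs)
sumℚ-*ˡ a h []       = sym (ℚP.*-zeroʳ a)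
sumℚ-*ˡ a h (x ∷ xs) rewrite sumℚ-*ˡ a h xs = sym (ℚP.*-distribˡ-+ a (h x) _)

sumℚ-*ʳ : ∀ {A : Set} a (h : A → ℚ) xs → sumℚ (map (λ x → h x ℚ.* a) xs) ≡ sumℚ (map h xs) ℚ.* a
sumℚ-*ʳ a h xs = trans (sumℚ-cong (λ x → ℚP.*-comm (h x) a) xs) (trans (sumℚ-*ˡ a h xs) (ℚP.*-comm a _))

sumℚ-filterᵇ : ∀ {A : Set} (h : A → ℚ) (Q : A → Bool) xs →
  sumℚ (map h (filterᵇ Q xs)) ≡ sumℚ (map (λ x → if Q x then h x else 0ℚ) xs)
sumℚ-filterᵇ h Q []       = refl
sumℚ-filterᵇ h Q (x ∷ xs) with Q x
... | true  = cong (h x ℚ.+_) (sumℚ-filterᵇ h Q xs)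
... | false = trans (sumℚ-filterᵇ h Q xs) (sym (ℚP.+-identityˡ _))

-- Measures of finite unions of cylinders

if-*ˡ : ∀ b a x → (if b then a ℚ.* x else 0ℚ) ≡ a ℚ.* (if b then x else 0ℚ)
if-*ˡ true  a x = refl
if-*ˡ false a x = sym (ℚP.*-zeroʳ a)

take-take : ∀ {A : Set} M N (τ : List A) → M ≤ N → take M (take N τ) ≡ take M τ
take-take zero    N       τ       _         = refl
take-take (suc M) (suc N) []      _         = refl
take-take (suc M) (suc N) (x ∷ τ) (s≤s M≤N) = cong (x ∷_) (take-take M N τ M≤N)

module _ {k : ℕ} where

  massAt : (Fin k → ℚ) → ℕ → (Str k → Bool) → ℚ
  massAt w N Q = sumℚ (map (λ τ → if Q τ then weight w τ else 0ℚ) (strs k N))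

  measU≡massAt : ∀ w L → measU w L ≡ massAt w (maxLen L) (anyPrefix L)
  measU≡massAt w L = sumℚ-filterᵇ (weight w) (anyPrefix L) (strs k (maxLen L))

  massAt-suc : ∀ w N Q → massAt w (suc N) Q ≡ sumℚ (map (λ c → w c ℚ.* massAt w N (λ τ → Q (c ∷ τ))) (allFin k))
  massAt-suc w N Q = trans (sumℚ-concatMap _ (λ c → map (c ∷_) (strs k N)) (allFin k)) (sumℚ-cong first-letter (allFin k))
    where
    first-letter : ∀ c → sumℚ (map (λ τ → if Q τ then weight w τ else 0ℚ) (map (c ∷_) (strs k N)))
                       ≡ w c ℚ.* massAt w N (λ τ → Q (c ∷ τ))
    first-letter c = begin
      sumℚ (map (λ τ → if Q τ then weight w τ else 0ℚ) (map (c ∷_) (strs k N)))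
        ≡⟨ cong sumℚ (sym (Listₚ.map-∘ (strs k N))) ⟩
      sumℚ (map (λ τ → if Q (c ∷ τ) then w c ℚ.* weight w τ else 0ℚ) (strs k N))
        ≡⟨ sumℚ-cong (λ τ → if-*ˡ (Q (c ∷ τ)) (w c) (weight w τ)) (strs k N) ⟩
      sumℚ (map (λ τ → w c ℚ.* (if Q (c ∷ τ) then weight w τ else 0ℚ)) (strs k N))
        ≡⟨ sumℚ-*ˡ (w c) _ (strs k N) ⟩
      w c ℚ.* massAt w N (λ τ → Q (c ∷ τ))
        ∎
      where open ≡-Reasoning

  weight-nonNeg : ∀ w → (∀ c → 0ℚ ℚ.≤ w c) → ∀ (τ : Str k) → 0ℚ ℚ.≤ weight w τ
  weight-nonNeg w w≥0 []      = ℚP.nonNegative⁻¹ 1ℚ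
  weight-nonNeg w w≥0 (c ∷ τ) = ℚP.nonNegative⁻¹ _
    {{ℚP.nonNeg*nonNeg⇒nonNeg (w c) {{ℚ.nonNegative (w≥0 c)}} (weight w τ) {{ℚ.nonNegative (weight-nonNeg w w≥0 τ)}}}}

  massAt-mono : ∀ w → (∀ c → 0ℚ ℚ.≤ w c) → ∀ N {Q Q′ : Str k → Bool} → (∀ τ → Q τ ≡ true → Q′ τ ≡ true) →
    massAt w N Q ℚ.≤ massAt w N Q′
  massAt-mono w w≥0 N {Q} {Q′} Q⇒Q′ = sumℚ-mono pointwise (strs k N)
    where
    pointwise : ∀ τ → (if Q τ then weight w τ else 0ℚ) ℚ.≤ (if Q′ τ then weight w τ else 0ℚ)
    pointwise τ with Q τ | Q⇒Q′ τ
    ... | true  | Q′τ rewrite Q′τ refl = ℚP.≤-refl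
    ... | false | _ with Q′ τ
    ...   | true  = weight-nonNeg w w≥0 τ
    ...   | false = ℚP.≤-refl

  DependsOnPrefix : ℕ → (Str k → Bool) → Set
  DependsOnPrefix N Q = ∀ τ → Q τ ≡ Q (take N τ)

  DependsOnPrefix-mono : ∀ {M N} {Q : Str k → Bool} → M ≤ N → DependsOnPrefix M Q → DependsOnPrefix N Q
  DependsOnPrefix-mono {M} {N} {Q} M≤N dep τ = trans (dep τ) (trans (cong Q (sym (take-take M N τ M≤N))) (sym (dep (take N τ))))

  -- refining a cylinder by one more letter keeps its mass, as the weights sum to 1
  massAt-refine : ∀ w → sumℚ (map w (allFin k)) ≡ 1ℚ → ∀ N Q → DependsOnPrefix N Q → massAt w N Q ≡ massAt w (suc N) Q
  massAt-refine w Σw≡1 zero Q dep = sym (begin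
    massAt w 1 Q                                                        ≡⟨ massAt-suc w zero Q ⟩
    sumℚ (map (λ c → w c ℚ.* massAt w 0 (λ τ → Q (c ∷ τ))) (allFin k))  ≡⟨ sumℚ-cong (λ c → cong (w c ℚ.*_) (drop-letter c)) (allFin k) ⟩
    sumℚ (map (λ c → w c ℚ.* massAt w 0 Q) (allFin k))                  ≡⟨ sumℚ-*ʳ (massAt w 0 Q) w (allFin k) ⟩
    sumℚ (map w (allFin k)) ℚ.* massAt w 0 Q                            ≡⟨ cong (ℚ._* massAt w 0 Q) Σw≡1 ⟩
    1ℚ ℚ.* massAt w 0 Q                                                 ≡⟨ ℚP.*-identityˡ _ ⟩
    massAt w 0 Q                                                        ∎)
    where
    open ≡-Reasoning
    drop-letter : ∀ c → massAt w 0 (λ τ → Q (c ∷ τ)) ≡ massAt w 0 Q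
    drop-letter c = cong (λ b → (if b then 1ℚ else 0ℚ) ℚ.+ 0ℚ) (dep (c ∷ []))
  massAt-refine w Σw≡1 (suc N) Q dep = begin
    massAt w (suc N) Q
      ≡⟨ massAt-suc w N Q ⟩
    sumℚ (map (λ c → w c ℚ.* massAt w N (λ τ → Q (c ∷ τ))) (allFin k))
      ≡⟨ sumℚ-cong (λ c → cong (w c ℚ.*_) (massAt-refine w Σw≡1 N (λ τ → Q (c ∷ τ)) (λ τ → dep (c ∷ τ)))) (allFin k) ⟩
    sumℚ (map (λ c → w c ℚ.* massAt w (suc N) (λ τ → Q (c ∷ τ))) (allFin k))
      ≡⟨ sym (massAt-suc w (suc N) Q) ⟩
    massAt w (suc (suc N)) Q
      ∎
    where open ≡-Reasoning

  massAt-stable : ∀ w → sumℚ (map w (allFin k)) ≡ 1ℚ → ∀ {M N} Q → M ≤ N → DependsOnPrefix M Q → massAt w M Q ≡ massAt w N Q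
  massAt-stable w Σw≡1 {M} Q M≤N dep = go (≤⇒≤′ M≤N)
    where
    go : ∀ {N} → M ≤′ N → massAt w M Q ≡ massAt w N Q
    go ≤′-refl = refl
    go (≤′-step {N} M≤′N) = trans (go M≤′N) (massAt-refine w Σw≡1 N Q (DependsOnPrefix-mono (≤′⇒≤ M≤′N) dep))

  measU≡massAt-≥ : ∀ w → sumℚ (map w (allFin k)) ≡ 1ℚ → ∀ L {N} → maxLen L ≤ N → measU w L ≡ massAt w N (anyPrefix L)
  measU≡massAt-≥ w Σw≡1 L L≤N =
    trans (measU≡massAt w L) (massAt-stable w Σw≡1 (anyPrefix L) L≤N (λ τ → anyPrefix-take L τ (maxLen L) ≤-refl))

PushesForward : ∀ {kd kb} → (Fin kd → ℚ) → (Fin kd → Fin kb) → (Fin kb → ℚ) → Set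
PushesForward {kd} {kb} u G p =
  ∀ (H : Fin kb → ℚ) → sumℚ (map (λ a → u a ℚ.* H (G a)) (allFin kd)) ≡ sumℚ (map (λ c → p c ℚ.* H c) (allFin kb))

module _ {kd kb} {u : Fin kd → ℚ} {G : Fin kd → Fin kb} {p : Fin kb → ℚ} (push : PushesForward u G p) where

  massAt-pullback : ∀ N (Q : Str kb → Bool) → massAt u N (λ τ → Q (map G τ)) ≡ massAt p N Q
  massAt-pullback zero    Q = refl
  massAt-pullback (suc N) Q = begin
    massAt u (suc N) (λ τ → Q (map G τ))
      ≡⟨ massAt-suc u N _ ⟩
    sumℚ (map (λ a → u a ℚ.* massAt u N (λ τ → Q (G a ∷ map G τ))) (allFin kd))
      ≡⟨ sumℚ-cong (λ a → cong (u a ℚ.*_) (massAt-pullback N (λ τ → Q (G a ∷ τ)))) (allFin kd) ⟩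
    sumℚ (map (λ a → u a ℚ.* massAt p N (λ τ → Q (G a ∷ τ))) (allFin kd))
      ≡⟨ push (λ c → massAt p N (λ τ → Q (c ∷ τ))) ⟩
    sumℚ (map (λ c → p c ℚ.* massAt p N (λ τ → Q (c ∷ τ))) (allFin kb))
      ≡⟨ sym (massAt-suc p N Q) ⟩
    massAt p (suc N) Q
      ∎
    where open ≡-Reasoning

  sumℚ-pushforward : sumℚ (map u (allFin kd)) ≡ sumℚ (map p (allFin kb))
  sumℚ-pushforward = begin
    sumℚ (map u (allFin kd))                        ≡⟨ sumℚ-cong (λ a → sym (ℚP.*-identityʳ (u a))) (allFin kd) ⟩
    sumℚ (map (λ a → u a ℚ.* 1ℚ) (allFin kd))       ≡⟨ push (λ _ → 1ℚ) ⟩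
    sumℚ (map (λ c → p c ℚ.* 1ℚ) (allFin kb))       ≡⟨ sumℚ-cong (λ c → ℚP.*-identityʳ (p c)) (allFin kb) ⟩
    sumℚ (map p (allFin kb))                        ∎
    where open ≡-Reasoning

  measU-mono-pullback : sumℚ (map p (allFin kb)) ≡ 1ℚ → (∀ a → 0ℚ ℚ.≤ u a) →
    ∀ (L : List (Str kb)) (L′ : List (Str kd)) → All (λ τ → anyPrefix L (map G τ) ≡ true) L′ → measU u L′ ℚ.≤ measU p L
  measU-mono-pullback Σp≡1 u≥0 L L′ L′⊆L = begin
    measU u L′                                ≡⟨ measU≡massAt-≥ u (trans sumℚ-pushforward Σp≡1) L′ (m≤m⊔n _ _) ⟩
    massAt u N (anyPrefix L′)                 ≤⟨ massAt-mono u u≥0 N (anyPrefix-map-⊆ G L L′ L′⊆L) ⟩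
    massAt u N (λ ρ → anyPrefix L (map G ρ))  ≡⟨ massAt-pullback N (anyPrefix L) ⟩
    massAt p N (anyPrefix L)                  ≡⟨ measU≡massAt-≥ p Σp≡1 L (m≤n⊔m (maxLen L′) _) ⟨
    measU p L                                 ∎
    where
    open ℚP.≤-Reasoning
    N = maxLen L′ ⊔ maxLen L

-- Pulling a Martin-Löf test back along a letter-to-letter map

signum-+-fromBool : ∀ S a b → signum S ≡ fromBool b → signum (S + 1 * fromBool a) ≡ fromBool (a ∨ b)
signum-+-fromBool S true  b _  rewrite +-comm S 1 = refl
signum-+-fromBool S false b eq rewrite +-identityʳ S = eq

module PullbackTest {kb kd} (G : Fin (suc kd) → Fin (suc kb)) (f : PR 2) where

  open PrefixTestPR G using (prefixTestPR; eval-prefixTestPR)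

  Covered : ℕ → ℕ → Bool
  Covered i s = anyPrefix (enumUpTo (suc kb) f i s) (map G (decode (suc kd) s))

  hit : ℕ → ℕ → Str (suc kb) → ℕ
  hit i t ρ = signum (eval f (i ∷ t ∷ [])) * fromBool (isPrefix (decode (suc kb) (pred (eval f (i ∷ t ∷ [])))) ρ)

  hitPR : PR 3
  hitPR = comp₂ mulPR (comp₁ signumPR (comp₂ f var₁ var₀)) (comp₂ prefixTestPR (comp₁ predPR (comp₂ f var₁ var₀)) var₂)

  eval-hitPR : ∀ t i s → eval hitPR (t ∷ i ∷ s ∷ []) ≡ hit i t (map G (decode (suc kd) s))
  eval-hitPR t i s rewrite eval-signumPR (eval f (i ∷ t ∷ [])) | eval-predPR (eval f (i ∷ t ∷ []))
                         | eval-prefixTestPR (pred (eval f (i ∷ t ∷ []))) s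
    = eval-mulPR (signum (eval f (i ∷ t ∷ []))) _

  signum-sum<-hit : ∀ i K ρ → signum (sum< K (λ t → hit i t ρ)) ≡ fromBool (anyPrefix (enumUpTo (suc kb) f i K) ρ)
  signum-sum<-hit i zero    ρ = refl
  signum-sum<-hit i (suc K) ρ with eval f (i ∷ K ∷ []) | signum-sum<-hit i K ρ
  ... | zero  | IH = trans (cong signum (+-identityʳ _)) IH
  ... | suc c | IH = signum-+-fromBool _ (isPrefix (decode (suc kb) c) ρ) _ IH

  coveredPR : PR 2
  coveredPR = comp₁ signumPR (comp (sumPR hitPR) (var₁ ∷ var₀ ∷ var₁ ∷ []))

  eval-coveredPR : ∀ i s → eval coveredPR (i ∷ s ∷ []) ≡ fromBool (Covered i s)
  eval-coveredPR i s rewrite eval-sumPR hitPR s (i ∷ s ∷ []) | sum<-cong s (λ t → eval-hitPR t i s) =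
    trans (eval-signumPR _) (signum-sum<-hit i s (map G (decode (suc kd) s)))

  -- at stage s the pulled-back test enumerates (the code) s itself, exactly when s is covered
  pullbackPR : PR 2
  pullbackPR = comp₂ mulPR coveredPR (comp₁ psucc var₁)

  eval-pullbackPR : ∀ i s → eval pullbackPR (i ∷ s ∷ []) ≡ fromBool (Covered i s) * suc s
  eval-pullbackPR i s rewrite eval-coveredPR i s = eval-mulPR (fromBool (Covered i s)) (suc s)

  pullbackPR-output : ∀ i s c → eval pullbackPR (i ∷ s ∷ []) ≡ suc c → c ≡ s × Covered i s ≡ true
  pullbackPR-output i s c eq with Covered i s | eval-pullbackPR i s
  ... | true  | e = suc-injective (trans (sym eq) (trans e (+-identityʳ (suc s)))) , refl
  ... | false | e with trans (sym eq) e
  ...   | ()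

  pullbackPR-enumerates : ∀ i s → Covered i s ≡ true → eval pullbackPR (i ∷ s ∷ []) ≡ suc s
  pullbackPR-enumerates i s covered = trans (eval-pullbackPR i s) (trans (cong (λ b → fromBool b * suc s) covered) (+-identityʳ (suc s)))

  enumUpTo-pullbackPR-⊆ : ∀ i s → All (λ τ → anyPrefix (enumUpTo (suc kb) f i s) (map G τ) ≡ true) (enumUpTo (suc kd) pullbackPR i s)
  enumUpTo-pullbackPR-⊆ i zero    = []
  enumUpTo-pullbackPR-⊆ i (suc s) with eval pullbackPR (i ∷ s ∷ []) in eq
  ... | zero  = All.map (anyPrefix-enumUpTo-suc (suc kb) f i s _) (enumUpTo-pullbackPR-⊆ i s)
  ... | suc c with pullbackPR-output i s c eq
  ...   | refl , covered = anyPrefix-enumUpTo-suc (suc kb) f i s _ covered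
                         ∷ All.map (anyPrefix-enumUpTo-suc (suc kb) f i s _) (enumUpTo-pullbackPR-⊆ i s)

module _ {kb kd} {u : Fin (suc kd) → ℚ} {G : Fin (suc kd) → Fin (suc kb)} {p : Fin (suc kb) → ℚ}
         (push : PushesForward u G p) (Σp≡1 : sumℚ (map p (allFin (suc kb))) ≡ 1ℚ) (u≥0 : ∀ a → 0ℚ ℚ.≤ u a) where

  pullbackTest : MLTest (suc kb) p → MLTest (suc kd) u
  pullbackTest T = record { code = pullbackPR ; bound = bound′ }
    where
    open PullbackTest G (code T)
    bound′ : ∀ i s → measU u (enumUpTo (suc kd) pullbackPR i s) ℚ.* ((+ (2 ^ i)) ℚ./ 1) ℚ.≤ 1ℚ
    bound′ i s = ℚP.≤-trans
      (ℚP.*-monoʳ-≤-nonNeg ((+ (2 ^ i)) ℚ./ 1) {{ℚP.normalize-nonNeg (2 ^ i) 1}}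
        (measU-mono-pullback push Σp≡1 u≥0 (enumUpTo (suc kb) (code T) i s) _ (enumUpTo-pullbackPR-⊆ i s)))
      (bound T i s)

  -- a long enough prefix of x, read as a code e, is itself enumerated (at stage e) by the pulled-back test
  Covers-pullbackTest : ∀ T (x : Seq (suc kd)) → Covers T (λ n → G (x n)) → Covers (pullbackTest T) x
  Covers-pullbackTest T x cov i with cov i
  ... | s , c , eq , ext = e , e , pullbackPR-enumerates i e covered , subst (Extends x) (sym decode-e) (Extends-prefixOf x N)
    where
    open PullbackTest G (code T)
    σ = decode (suc kb) c
    N = length σ + suc s
    e = encode (prefixOf x N)
    decode-e : decode (suc kd) e ≡ prefixOf x N
    decode-e = decode-encode (prefixOf x N)
    N≤e : N ≤ e
    N≤e = subst (_≤ e) (length-prefixOf x N) (length≤encode (prefixOf x N))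
    covered-at-suc-s : anyPrefix (enumUpTo (suc kb) (code T) i (suc s)) (prefixOf (λ n → G (x n)) N) ≡ true
    covered-at-suc-s = anyPrefix-enumUpTo-hit (suc kb) (code T) i s c _ eq
            (Extends⇒isPrefix-prefixOf (λ n → G (x n)) σ N ext (m≤m+n (length σ) (suc s)))
    covered : Covered i e ≡ true
    covered = subst (λ τ → anyPrefix (enumUpTo (suc kb) (code T) i e) τ ≡ true)
                (sym (trans (cong (map G) decode-e) (map-prefixOf G x N)))
                (anyPrefix-enumUpTo-mono (suc kb) (code T) i _ (≤-trans (m≤n+m (suc s) (length σ)) N≤e) covered-at-suc-s)

  MLRandom-map : ∀ x → MLRandom (suc kd) u x → MLRandom (suc kb) p (λ n → G (x n))
  MLRandom-map x random T cov = random (pullbackTest T) (Covers-pullbackTest T x cov)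

fromℕ : ℕ → ℚ
fromℕ n = mkℚ (+ n) 0 (Coprime.sym (1-coprimeTo n))

fromℕ-injective : ∀ {m n} → fromℕ m ≡ fromℕ n → m ≡ n
fromℕ-injective eq = cong (λ r → ℤ.∣ ↥ r ∣) eq

fromℕ-+ : ∀ m n → fromℕ (m + n) ≡ fromℕ m ℚ.+ fromℕ n
fromℕ-+ m n = ℚP.toℚᵘ-injective (ℚᵘP.≃-trans m+n≃ (ℚᵘP.≃-sym (ℚP.toℚᵘ-homo-+ (fromℕ m) (fromℕ n))))
  where
  m+n≃ : mkℚᵘ (+ (m + n)) 0 ℚᵘ.≃ mkℚᵘ (+ m) 0 ℚᵘ.+ mkℚᵘ (+ n) 0
  m+n≃ = *≡* (cong (ℤ._* + 1) (trans (ℤP.pos-+ m n) (sym (cong₂ ℤ._+_ (ℤP.*-identityʳ (+ m)) (ℤP.*-identityʳ (+ n))))))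

fromℕ-length : ∀ {A : Set} (xs : List A) → fromℕ (length xs) ≡ sumℚ (map (λ _ → 1ℚ) xs)
fromℕ-length []       = refl
fromℕ-length (x ∷ xs) = trans (fromℕ-+ 1 (length xs)) (cong (1ℚ ℚ.+_) (fromℕ-length xs))

fromℕ[∣↥p∣*n]≡fromℕ[n*↧p]*p : ∀ p n → 0ℚ ℚ.< p → fromℕ (ℤ.∣ ↥ p ∣ * n) ≡ fromℕ (n * ↧ₙ p) ℚ.* p
fromℕ[∣↥p∣*n]≡fromℕ[n*↧p]*p p@(mkℚ (+ a) d _) n _ =
  ℚP.toℚᵘ-injective (ℚᵘP.≃-trans an≃ (ℚᵘP.≃-sym (ℚP.toℚᵘ-homo-* (fromℕ (n * suc d)) p)))
  where
  an≃ : mkℚᵘ (+ (a * n)) 0 ℚᵘ.≃ mkℚᵘ (+ (n * suc d)) 0 ℚᵘ.* mkℚᵘ (+ a) d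
  an≃ = *≡* (begin
    + (a * n) ℤ.* + suc (d + 0 * suc d)  ≡⟨ ℤP.pos-* (a * n) _ ⟨
    + (a * n * suc (d + 0 * suc d))      ≡⟨ cong +_ (reorder a n d) ⟩
    + (n * suc d * a * 1)                ≡⟨ ℤP.pos-* (n * suc d * a) 1 ⟩
    + (n * suc d * a) ℤ.* + 1            ≡⟨ cong (ℤ._* + 1) (ℤP.pos-* (n * suc d) a) ⟩
    + (n * suc d) ℤ.* + a ℤ.* + 1        ∎)
    where
    open ≡-Reasoning
    reorder : ∀ a n d → a * n * suc (d + 0 * suc d) ≡ n * suc d * a * 1
    reorder = solve-∀
fromℕ[∣↥p∣*n]≡fromℕ[n*↧p]*p (mkℚ -[1+ _ ] _ _) n p>0 with () ← ℚ.positive p>0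

uniformP-*-fromℕ : ∀ k a → uniformP (suc k) a ℚ.* fromℕ (suc k) ≡ 1ℚ
uniformP-*-fromℕ k a = ℚP.toℚᵘ-injective (begin-equality
  toℚᵘ (uniformP (suc k) a ℚ.* fromℕ (suc k))              ≃⟨ ℚP.toℚᵘ-homo-* (uniformP (suc k) a) (fromℕ (suc k)) ⟩
  toℚᵘ (uniformP (suc k) a) ℚᵘ.* mkℚᵘ (+ suc k) 0          ≃⟨ ℚᵘP.*-congʳ (ℚP.toℚᵘ-fromℚᵘ (mkℚᵘ (+ 1) k)) ⟩
  mkℚᵘ (+ 1) k ℚᵘ.* mkℚᵘ (+ suc k) 0                       ≃⟨ *≡* (cong (λ m → + suc m) (reorder k)) ⟩
  mkℚᵘ (+ 1) 0                                             ∎)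
  where
  open ℚᵘP.≤-Reasoning
  reorder : ∀ k → (k + 0) * 1 ≡ k * 1 + 0
  reorder = solve-∀

-- The block g

∣foldr-lcm : ∀ {A : Set} (h : A → ℕ) {x} xs → x ∈ xs → h x ∣ List.foldr (λ y acc → lcm (h y) acc) 1 xs
∣foldr-lcm h (y ∷ ys) (here refl) = m∣lcm[m,n] (h y) _
∣foldr-lcm h (y ∷ ys) (there x∈ys) = ∣-trans (∣foldr-lcm h ys x∈ys) (n∣lcm[m,n] (h y) _)

sumℚ-replicate : ∀ {A : Set} (h : A → ℚ) m y → sumℚ (map h (replicate m y)) ≡ fromℕ m ℚ.* h y
sumℚ-replicate h zero    y = sym (ℚP.*-zeroˡ (h y))
sumℚ-replicate h (suc m) y = begin
  h y ℚ.+ sumℚ (map h (replicate m y))   ≡⟨ cong (h y ℚ.+_) (sumℚ-replicate h m y) ⟩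
  h y ℚ.+ fromℕ m ℚ.* h y                ≡⟨ cong (ℚ._+ fromℕ m ℚ.* h y) (ℚP.*-identityˡ (h y)) ⟨
  1ℚ ℚ.* h y ℚ.+ fromℕ m ℚ.* h y         ≡⟨ ℚP.*-distribʳ-+ (h y) 1ℚ (fromℕ m) ⟨
  (1ℚ ℚ.+ fromℕ m) ℚ.* h y               ≡⟨ cong (ℚ._* h y) (fromℕ-+ 1 m) ⟨
  fromℕ (suc m) ℚ.* h y                  ∎
  where open ≡-Reasoning

sumℚ-tabulate-nthOr : ∀ {A : Set} (z : A) (h : A → ℚ) L {m} → length L ≡ m →
  sumℚ (tabulate (λ (a : Fin m) → h (nthOr z L (toℕ a)))) ≡ sumℚ (map h L)
sumℚ-tabulate-nthOr z h []      refl = refl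
sumℚ-tabulate-nthOr z h (y ∷ L) refl = cong (h y ℚ.+_) (sumℚ-tabulate-nthOr z h L refl)

module Block {n} (p : Fin (suc (suc n)) → ℚ) (p>0 : ∀ i → 0ℚ ℚ.< p i) where

  fromℕ-copies : ∀ i → fromℕ (copies p i) ≡ fromℕ (lcmDen p) ℚ.* p i
  fromℕ-copies i = trans (fromℕ[∣↥p∣*n]≡fromℕ[n*↧p]*p (p i) (lcmDen p / ↧ₙ (p i)) (p>0 i))
                         (cong (λ m → fromℕ m ℚ.* p i) (m/n*n≡m (∣foldr-lcm (λ j → ↧ₙ (p j)) (allFin _) (∈-allFin i))))

  sumℚ-gBlock : ∀ h → sumℚ (map h (gBlock p)) ≡ fromℕ (lcmDen p) ℚ.* sumℚ (map (λ i → p i ℚ.* h i) (allFin (suc (suc n))))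
  sumℚ-gBlock h = begin
    sumℚ (map h (gBlock p))
      ≡⟨ sumℚ-concatMap h (λ i → replicate (copies p i) i) (allFin _) ⟩
    sumℚ (map (λ i → sumℚ (map h (replicate (copies p i) i))) (allFin _))
      ≡⟨ sumℚ-cong (λ i → trans (sumℚ-replicate h (copies p i) i) (cong (ℚ._* h i) (fromℕ-copies i))) (allFin _) ⟩
    sumℚ (map (λ i → fromℕ (lcmDen p) ℚ.* p i ℚ.* h i) (allFin _))
      ≡⟨ sumℚ-cong (λ i → ℚP.*-assoc (fromℕ (lcmDen p)) (p i) (h i)) (allFin _) ⟩
    sumℚ (map (λ i → fromℕ (lcmDen p) ℚ.* (p i ℚ.* h i)) (allFin _))
      ≡⟨ sumℚ-*ˡ (fromℕ (lcmDen p)) (λ i → p i ℚ.* h i) (allFin _) ⟩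
    fromℕ (lcmDen p) ℚ.* sumℚ (map (λ i → p i ℚ.* h i) (allFin _))
      ∎
    where open ≡-Reasoning

  module _ (Σp≡1 : sumℚ (map p (allFin (suc (suc n)))) ≡ 1ℚ) where

    length-gBlock : length (gBlock p) ≡ lcmDen p
    length-gBlock = fromℕ-injective (begin
      fromℕ (length (gBlock p))
        ≡⟨ fromℕ-length (gBlock p) ⟩
      sumℚ (map (λ _ → 1ℚ) (gBlock p))
        ≡⟨ sumℚ-gBlock (λ _ → 1ℚ) ⟩
      fromℕ (lcmDen p) ℚ.* sumℚ (map (λ i → p i ℚ.* 1ℚ) (allFin _))
        ≡⟨ cong (fromℕ (lcmDen p) ℚ.*_) (trans (sumℚ-cong (λ i → ℚP.*-identityʳ (p i)) (allFin _)) Σp≡1) ⟩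
      fromℕ (lcmDen p) ℚ.* 1ℚ
        ≡⟨ ℚP.*-identityʳ _ ⟩
      fromℕ (lcmDen p)
        ∎)
      where open ≡-Reasoning

    gAt-pushesForward : ∀ {k} → lcmDen p ≡ suc k → PushesForward (uniformP (suc k)) (λ a → gAt p (toℕ a)) p
    gAt-pushesForward {k} d≡ h = begin
      sumℚ (map (λ a → δ ℚ.* h (gAt p (toℕ a))) (allFin (suc k)))
        ≡⟨ cong sumℚ (Listₚ.map-tabulate {n = suc k} (λ a → a) (λ a → δ ℚ.* h (gAt p (toℕ a)))) ⟩
      sumℚ (tabulate (λ (a : Fin (suc k)) → δ ℚ.* h (gAt p (toℕ a))))
        ≡⟨ sumℚ-tabulate-nthOr Fin.zero (λ c → δ ℚ.* h c) (gBlock p) {suc k} (trans length-gBlock d≡) ⟩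
      sumℚ (map (λ c → δ ℚ.* h c) (gBlock p))
        ≡⟨ sumℚ-*ˡ δ h (gBlock p) ⟩
      δ ℚ.* sumℚ (map h (gBlock p))
        ≡⟨ cong (δ ℚ.*_) (sumℚ-gBlock h) ⟩
      δ ℚ.* (fromℕ (lcmDen p) ℚ.* E)
        ≡⟨ cong (λ m → δ ℚ.* (fromℕ m ℚ.* E)) d≡ ⟩
      δ ℚ.* (fromℕ (suc k) ℚ.* E)
        ≡⟨ ℚP.*-assoc δ (fromℕ (suc k)) E ⟨
      δ ℚ.* fromℕ (suc k) ℚ.* E
        ≡⟨ cong (ℚ._* E) (uniformP-*-fromℕ k Fin.zero) ⟩
      1ℚ ℚ.* E
        ≡⟨ ℚP.*-identityˡ E ⟩
      E
        ∎
      where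
      open ≡-Reasoning
      δ = uniformP (suc k) Fin.zero
      E = sumℚ (map (λ i → p i ℚ.* h i) (allFin (suc (suc n))))

    MLRandom-gAt : ∀ {D} → lcmDen p ≡ D → (x : Seq D) →
      MLRandom D (uniformP D) x → MLRandom (suc (suc n)) p (λ m → gAt p (toℕ (x m)))
    MLRandom-gAt {zero}  _  x = ⊥-elim (¬Fin0 (x 0))
    MLRandom-gAt {suc k} d≡ x = MLRandom-map (gAt-pushesForward d≡) Σp≡1 uniformP≥0 x
      where
      uniformP≥0 : ∀ a → 0ℚ ℚ.≤ uniformP (suc k) a
      uniformP≥0 a = ℚP.nonNegative⁻¹ _ {{ℚP.normalize-nonNeg 1 (suc k)}}

theorem3p4 : (n : ℕ) (p : Fin (suc (suc n)) → ℚ)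
    → (∀ i → 0ℚ ℚ.< p i)
    → sumℚ (map p (allFin (suc (suc n)))) ≡ 1ℚ
    → (x : Seq (lcmDen p))
    → (∀ m → Σ ℕ λ k → (m ≤ k) × (toℕ (x k) ≢ pred (lcmDen p)))
    → MLRandom (lcmDen p) (uniformP (lcmDen p)) x
    → MLRandom (suc (suc n)) p (beta p x)
theorem3p4 n p p>0 Σp≡1 x _ = Block.MLRandom-gAt p p>0 Σp≡1 refl x
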